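{- Let $m \in \mathbb{F}_2[t]$ be an odd polynomial (i.e. $m(0)=1$) with $\deg m = d$, and let $T$ be the map $T(f) = f/t$ if $f \equiv 0 \pmod t$, $T(f) = (mf+1)/t$ otherwise. For $f\in\mathbb{F}_2[t]$ define its parity sequence $(p_0,p_1,p_2,\ldots)$ by $p_k = (T^k(f))(0) \in \{0,1\}$. Fix $N \ge 1$. Then the first $N$ terms of the parity sequence of $f$ depend only on $f \bmod t^N$, and the resulting map $\Phi_m : \mathbb{F}_2[t]/(t^N) \to \{0,1\}^N$ sending $f \bmod t^N$ to $(p_0,\ldots,p_{N-1})$ is a bijection. That is, every sequence $(p_0,\ldots,p_{N-1}) \in \{0,1\}^N$ is the first $N$ terms of the parity sequence of a unique polynomial $g \in \mathbb{F}_2[t]$ with $\deg g < N$. Moreover, for this sequence, with $s(N) = \sum_{i=0}^{N-1} p_i$, there exists $h \in \mathbb{F}_2[t]$ with $\deg h < d\, s(N)$ such that the polynomials $f$ whose parity sequence begins with $(p_0,\ldots,p_{N-1})$ are exactly those of the form $f = g + t^N q$ with $q \in \mathbb{F}_2[t]$, and for each such $f$, $$T^N(f) = h + m^{s(N)} q.$$ Consequently, the first $N$ terms of the parity sequence of a polynomial chosen uniformly among polynomials of degree less than $N$ are uniformly distributed in $\{0,1\}^N$.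
   Context: The degree of the zero polynomial is $-\infty$; $T^k$ denotes the $k$-th iterate of $T$. -}

module Defs where

open import Data.Bool using (Bool; true; false; _xor_; _∧_; if_then_else_)
open import Data.Nat using (ℕ; zero; suc; _≤_; _+_)
open import Data.List using (List; []; _∷_; replicate; _++_)
open import Data.Vec using (Vec; tabulate; toList)
import Data.Vec as V
open import Data.Fin using (toℕ)
open import Relation.Binary.PropositionalEquality using (_≡_)

-- Polynomials over F₂ as coefficient lists, lowest degree first
-- (Bool = F₂ with xor as + and ∧ as ·).  Trailing zeros are allowed,
-- so polynomial equality is the coefficientwise relation _≈ₚ_.
Poly : Set
Poly = List Bool

coeff : Poly → ℕ → Bool
coeff []      _       = false
coeff (b ∷ p) zero    = b
coeff (b ∷ p) (suc i) = coeff p i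

infix 4 _≈ₚ_
_≈ₚ_ : Poly → Poly → Set
p ≈ₚ q = ∀ i → coeff p i ≡ coeff q i

-- deg p < n   (the zero polynomial has degree -∞, so it satisfies this for all n)
DegLt : Poly → ℕ → Set
DegLt p n = ∀ i → n ≤ i → coeff p i ≡ false

record Deg (p : Poly) (d : ℕ) : Set where
  field
    lead  : coeff p d ≡ true
    above : ∀ i → suc d ≤ i → coeff p i ≡ false

infixl 6 _+ₚ_
infixl 7 _*ₚ_

_+ₚ_ : Poly → Poly → Poly
[]      +ₚ q       = q
(a ∷ p) +ₚ []      = a ∷ p
(a ∷ p) +ₚ (b ∷ q) = (a xor b) ∷ (p +ₚ q)

scale : Bool → Poly → Poly
scale a []      = []
scale a (b ∷ q) = (a ∧ b) ∷ scale a q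

_*ₚ_ : Poly → Poly → Poly
[]      *ₚ q = []
(a ∷ p) *ₚ q = scale a q +ₚ (false ∷ (p *ₚ q))

oneₚ : Poly
oneₚ = true ∷ []

shift : ℕ → Poly → Poly
shift n p = replicate n false ++ p

_^ₚ_ : Poly → ℕ → Poly
p ^ₚ zero  = oneₚ
p ^ₚ suc n = p *ₚ (p ^ₚ n)

divT : Poly → Poly
divT []      = []
divT (_ ∷ p) = p

T : Poly → Poly → Poly
T m f = if coeff f 0 then divT (m *ₚ f +ₚ oneₚ) else divT f

Tⁿ : Poly → ℕ → Poly → Poly
Tⁿ m zero    f = f
Tⁿ m (suc k) f = Tⁿ m k (T m f)

parity : Poly → Poly → ℕ → Bool
parity m f k = coeff (Tⁿ m k f) 0

prefix : Poly → (N : ℕ) → Poly → Vec Bool N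
prefix m N f = tabulate (λ i → parity m f (toℕ i))

weight : ∀ {N} → Vec Bool N → ℕ
weight V.[]            = 0
weight (true  V.∷ bs) = suc (weight bs)
weight (false V.∷ bs) = weight bs

-- Φ_m on polynomials of degree < N, given by their coefficient vector
Φ : Poly → (N : ℕ) → Vec Bool N → Vec Bool N
Φ m N c = prefix m N (toList c)

-- Write f = g + t^N q with deg g < N. One step of T sends g + t^(k+1) q to
-- T g + t^k q′, where q′ is m q or q according to the parity of g, which is
-- also the parity of f. Iterating N times, the first N parities of f are
-- those of g, and T^N f = T^N g + m^s q. Conversely, as m(0) = 1 makes m a
-- unit modulo every t^k, the parity of f together with T f mod t^k
-- determines f mod t^(k+1), and every such pair occurs; by induction on N the
-- map g ↦ (p_0, …, p_(N-1)) is a bijection on polynomials of degree < N.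
module Submission where

open import Defs
open import Algebra.Bundles using (CommutativeRing)
open import Data.Bool using (Bool; true; false; _xor_; _∧_; if_then_else_)
open import Data.Bool.Properties
  using ( xor-identityʳ; xor-same; xor-comm; ∧-comm; ∧-assoc; ∧-zeroʳ
        ; ∧-distribˡ-xor; not-injective; xor-∧-commutativeRing )
open import Algebra.Properties.CommutativeSemigroup
  (CommutativeRing.+-commutativeSemigroup xor-∧-commutativeRing)
  using (interchange; x∙yz≈y∙xz)
open import Data.List using ([]; _∷_; take; drop)
open import Data.List.Properties using (drop-[])
open import Data.Nat using (ℕ; zero; suc; _≤_; _<_; _+_; _*_; z≤n; s≤s)
open import Data.Nat.Properties using (<-≤-connex; ≤-trans; m≤n+m; +-comm; +-assoc; +-identityʳ; *-suc; *-zeroʳ)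
open import Data.Product using (Σ; ∃; ∃-syntax; _×_; _,_)
open import Data.Sum using (inj₁; inj₂)
open import Data.Vec using (Vec; toList)
import Data.Vec as Vec
open import Function.Consequences.Propositional using (strictlySurjective⇒surjective)
open import Function.Definitions using (Bijective)
open import Relation.Binary.Bundles using (Setoid)
open import Relation.Binary.PropositionalEquality
import Relation.Binary.Reasoning.Setoid as SetoidReasoning

xor-cancelˡ : ∀ a {b c} → a xor b ≡ a xor c → b ≡ c
xor-cancelˡ false eq = eq
xor-cancelˡ true  eq = not-injective eq

-- Polynomial arithmetic up to _≈ₚ_
--
-- _≈ₚ_ unfolds to a Π-type, so Agda cannot infer the polynomials related by a
-- proof of it; they are therefore often supplied explicitly.

≈ₚ-refl : ∀ {p} → p ≈ₚ p
≈ₚ-refl i = refl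

≈ₚ-sym : ∀ {p q} → p ≈ₚ q → q ≈ₚ p
≈ₚ-sym e i = sym (e i)

≈ₚ-trans : ∀ {p q r} → p ≈ₚ q → q ≈ₚ r → p ≈ₚ r
≈ₚ-trans e f i = trans (e i) (f i)

≈ₚ-setoid : Setoid _ _
≈ₚ-setoid = record
  { Carrier = Poly
  ; _≈_ = _≈ₚ_
  ; isEquivalence = record
    { refl  = λ {p} → ≈ₚ-refl {p}
    ; sym   = λ {p} {q} → ≈ₚ-sym {p} {q}
    ; trans = λ {p} {q} {r} → ≈ₚ-trans {p} {q} {r}
    }
  }

module ≈ₚ-Reasoning = SetoidReasoning ≈ₚ-setoid

coeff-+ₚ : ∀ p q i → coeff (p +ₚ q) i ≡ coeff p i xor coeff q i
coeff-+ₚ []      q       i       = refl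
coeff-+ₚ (a ∷ p) []      i       = sym (xor-identityʳ _)
coeff-+ₚ (a ∷ p) (b ∷ q) zero    = refl
coeff-+ₚ (a ∷ p) (b ∷ q) (suc i) = coeff-+ₚ p q i

coeff-scale : ∀ a q i → coeff (scale a q) i ≡ a ∧ coeff q i
coeff-scale a []      i       = sym (∧-zeroʳ a)
coeff-scale a (b ∷ q) zero    = refl
coeff-scale a (b ∷ q) (suc i) = coeff-scale a q i

coeff-divT : ∀ p i → coeff (divT p) i ≡ coeff p (suc i)
coeff-divT []      i = refl
coeff-divT (_ ∷ p) i = refl

coeff-*ₚ-zero : ∀ a c → coeff (a *ₚ c) 0 ≡ coeff a 0 ∧ coeff c 0
coeff-*ₚ-zero []      c = refl
coeff-*ₚ-zero (x ∷ a) c =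
  trans (coeff-+ₚ (scale x c) _ 0) (trans (xor-identityʳ _) (coeff-scale x c 0))

coeff-*ₚ-suc : ∀ a c i →
  coeff (a *ₚ c) (suc i) ≡ (coeff a 0 ∧ coeff c (suc i)) xor coeff (divT a *ₚ c) i
coeff-*ₚ-suc []      c i = refl
coeff-*ₚ-suc (x ∷ a) c i =
  trans (coeff-+ₚ (scale x c) _ (suc i)) (cong (_xor coeff (a *ₚ c) i) (coeff-scale x c (suc i)))

coeff-*ₚ-sucʳ : ∀ a c i →
  coeff (a *ₚ c) (suc i) ≡ (coeff c 0 ∧ coeff a (suc i)) xor coeff (a *ₚ divT c) i
coeff-*ₚ-sucʳ a c zero = begin
  coeff (a *ₚ c) 1
    ≡⟨ coeff-*ₚ-suc a c 0 ⟩
  (coeff a 0 ∧ coeff c 1) xor coeff (divT a *ₚ c) 0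
    ≡⟨ cong₂ _xor_ (cong (coeff a 0 ∧_) (sym (coeff-divT c 0))) (coeff-*ₚ-zero (divT a) c) ⟩
  (coeff a 0 ∧ coeff (divT c) 0) xor (coeff (divT a) 0 ∧ coeff c 0)
    ≡⟨ xor-comm (coeff a 0 ∧ coeff (divT c) 0) _ ⟩
  (coeff (divT a) 0 ∧ coeff c 0) xor (coeff a 0 ∧ coeff (divT c) 0)
    ≡⟨ cong₂ _xor_ (trans (∧-comm (coeff (divT a) 0) (coeff c 0)) (cong (coeff c 0 ∧_) (coeff-divT a 0)))
                   (sym (coeff-*ₚ-zero a (divT c))) ⟩
  (coeff c 0 ∧ coeff a 1) xor coeff (a *ₚ divT c) 0
    ∎
  where open ≡-Reasoning
coeff-*ₚ-sucʳ a c (suc i) = begin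
  coeff (a *ₚ c) (suc (suc i))
    ≡⟨ coeff-*ₚ-suc a c (suc i) ⟩
  (a₀ ∧ c′) xor coeff (divT a *ₚ c) (suc i)
    ≡⟨ cong ((a₀ ∧ c′) xor_) (coeff-*ₚ-sucʳ (divT a) c i) ⟩
  (a₀ ∧ c′) xor ((coeff c 0 ∧ coeff (divT a) (suc i)) xor rest)
    ≡⟨ x∙yz≈y∙xz (a₀ ∧ c′) (coeff c 0 ∧ coeff (divT a) (suc i)) rest ⟩
  (coeff c 0 ∧ coeff (divT a) (suc i)) xor ((a₀ ∧ c′) xor rest)
    ≡⟨ cong₂ _xor_ (cong (coeff c 0 ∧_) (coeff-divT a (suc i)))
                   (cong (λ x → (a₀ ∧ x) xor rest) (sym (coeff-divT c (suc i)))) ⟩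
  (coeff c 0 ∧ coeff a (suc (suc i))) xor ((a₀ ∧ coeff (divT c) (suc i)) xor rest)
    ≡⟨ cong ((coeff c 0 ∧ coeff a (suc (suc i))) xor_) (sym (coeff-*ₚ-suc a (divT c) i)) ⟩
  (coeff c 0 ∧ coeff a (suc (suc i))) xor coeff (a *ₚ divT c) (suc i)
    ∎
  where
  open ≡-Reasoning
  a₀ c′ rest : Bool
  a₀   = coeff a 0
  c′   = coeff c (suc (suc i))
  rest = coeff (divT a *ₚ divT c) i

coeff-shift-< : ∀ n q {i} → i < n → coeff (shift n q) i ≡ false
coeff-shift-< (suc n) q {zero}  _         = refl
coeff-shift-< (suc n) q {suc i} (s≤s i<n) = coeff-shift-< n q i<n

divT-cong : ∀ {p q} → p ≈ₚ q → divT p ≈ₚ divT q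
divT-cong {p} {q} e i = trans (coeff-divT p i) (trans (e (suc i)) (sym (coeff-divT q i)))

divT-+ₚ : ∀ p q → divT (p +ₚ q) ≈ₚ divT p +ₚ divT q
divT-+ₚ p q i = begin
  coeff (divT (p +ₚ q)) i                 ≡⟨ coeff-divT (p +ₚ q) i ⟩
  coeff (p +ₚ q) (suc i)                  ≡⟨ coeff-+ₚ p q (suc i) ⟩
  coeff p (suc i) xor coeff q (suc i)     ≡⟨ sym (cong₂ _xor_ (coeff-divT p i) (coeff-divT q i)) ⟩
  coeff (divT p) i xor coeff (divT q) i   ≡⟨ sym (coeff-+ₚ (divT p) (divT q) i) ⟩
  coeff (divT p +ₚ divT q) i              ∎
  where open ≡-Reasoning

shift-cong : ∀ n {p q} → p ≈ₚ q → shift n p ≈ₚ shift n q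
shift-cong zero    e i       = e i
shift-cong (suc n) e zero    = refl
shift-cong (suc n) e (suc i) = shift-cong n e i

+ₚ-cong : ∀ {a b c d} → a ≈ₚ b → c ≈ₚ d → a +ₚ c ≈ₚ b +ₚ d
+ₚ-cong {a} {b} {c} {d} e f i =
  trans (coeff-+ₚ a c i) (trans (cong₂ _xor_ (e i) (f i)) (sym (coeff-+ₚ b d i)))

*ₚ-cong : ∀ {a b c d} → a ≈ₚ b → c ≈ₚ d → a *ₚ c ≈ₚ b *ₚ d
*ₚ-cong {a} {b} {c} {d} e f zero =
  trans (coeff-*ₚ-zero a c) (trans (cong₂ _∧_ (e 0) (f 0)) (sym (coeff-*ₚ-zero b d)))
*ₚ-cong {a} {b} {c} {d} e f (suc i) =
  trans (coeff-*ₚ-suc a c i)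
    (trans (cong₂ _xor_ (cong₂ _∧_ (e 0) (f (suc i))) (*ₚ-cong {divT a} {divT b} {c} {d} (divT-cong {a} {b} e) f i))
      (sym (coeff-*ₚ-suc b d i)))

*ₚ-identityˡ : ∀ q → oneₚ *ₚ q ≈ₚ q
*ₚ-identityˡ q zero    = coeff-*ₚ-zero oneₚ q
*ₚ-identityˡ q (suc i) = trans (coeff-*ₚ-suc oneₚ q i) (xor-identityʳ _)

*ₚ-comm : ∀ a b → a *ₚ b ≈ₚ b *ₚ a
*ₚ-comm a b zero    = trans (coeff-*ₚ-zero a b) (trans (∧-comm (coeff a 0) (coeff b 0)) (sym (coeff-*ₚ-zero b a)))
*ₚ-comm a b (suc i) =
  trans (coeff-*ₚ-suc a b i)
    (trans (cong ((coeff a 0 ∧ coeff b (suc i)) xor_) (*ₚ-comm (divT a) b i)) (sym (coeff-*ₚ-sucʳ b a i)))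

*ₚ-distribˡ-+ₚ : ∀ a b c → a *ₚ (b +ₚ c) ≈ₚ a *ₚ b +ₚ a *ₚ c
*ₚ-distribˡ-+ₚ a b c zero = begin
  coeff (a *ₚ (b +ₚ c)) 0                             ≡⟨ coeff-*ₚ-zero a (b +ₚ c) ⟩
  coeff a 0 ∧ coeff (b +ₚ c) 0                        ≡⟨ cong (coeff a 0 ∧_) (coeff-+ₚ b c 0) ⟩
  coeff a 0 ∧ (coeff b 0 xor coeff c 0)               ≡⟨ ∧-distribˡ-xor (coeff a 0) _ _ ⟩
  (coeff a 0 ∧ coeff b 0) xor (coeff a 0 ∧ coeff c 0) ≡⟨ sym (cong₂ _xor_ (coeff-*ₚ-zero a b) (coeff-*ₚ-zero a c)) ⟩
  coeff (a *ₚ b) 0 xor coeff (a *ₚ c) 0               ≡⟨ sym (coeff-+ₚ (a *ₚ b) (a *ₚ c) 0) ⟩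
  coeff (a *ₚ b +ₚ a *ₚ c) 0                          ∎
  where open ≡-Reasoning
*ₚ-distribˡ-+ₚ a b c (suc i) = begin
  coeff (a *ₚ (b +ₚ c)) (suc i)
    ≡⟨ coeff-*ₚ-suc a (b +ₚ c) i ⟩
  (a₀ ∧ coeff (b +ₚ c) (suc i)) xor coeff (divT a *ₚ (b +ₚ c)) i
    ≡⟨ cong₂ _xor_ (trans (cong (a₀ ∧_) (coeff-+ₚ b c (suc i))) (∧-distribˡ-xor a₀ _ _))
                   (trans (*ₚ-distribˡ-+ₚ (divT a) b c i) (coeff-+ₚ (divT a *ₚ b) _ i)) ⟩
  ((a₀ ∧ coeff b (suc i)) xor (a₀ ∧ coeff c (suc i))) xor (coeff (divT a *ₚ b) i xor coeff (divT a *ₚ c) i)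
    ≡⟨ interchange (a₀ ∧ coeff b (suc i)) (a₀ ∧ coeff c (suc i)) (coeff (divT a *ₚ b) i) _ ⟩
  ((a₀ ∧ coeff b (suc i)) xor coeff (divT a *ₚ b) i) xor ((a₀ ∧ coeff c (suc i)) xor coeff (divT a *ₚ c) i)
    ≡⟨ sym (cong₂ _xor_ (coeff-*ₚ-suc a b i) (coeff-*ₚ-suc a c i)) ⟩
  coeff (a *ₚ b) (suc i) xor coeff (a *ₚ c) (suc i)
    ≡⟨ sym (coeff-+ₚ (a *ₚ b) (a *ₚ c) (suc i)) ⟩
  coeff (a *ₚ b +ₚ a *ₚ c) (suc i) ∎
  where
  open ≡-Reasoning
  a₀ : Bool
  a₀ = coeff a 0

*ₚ-distribʳ-+ₚ : ∀ a b c → (a +ₚ b) *ₚ c ≈ₚ a *ₚ c +ₚ b *ₚ c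
*ₚ-distribʳ-+ₚ a b c = begin
  (a +ₚ b) *ₚ c       ≈⟨ *ₚ-comm (a +ₚ b) c ⟩
  c *ₚ (a +ₚ b)       ≈⟨ *ₚ-distribˡ-+ₚ c a b ⟩
  c *ₚ a +ₚ c *ₚ b    ≈⟨ +ₚ-cong {c *ₚ a} {a *ₚ c} {c *ₚ b} {b *ₚ c} (*ₚ-comm c a) (*ₚ-comm c b) ⟩
  a *ₚ c +ₚ b *ₚ c    ∎
  where open ≈ₚ-Reasoning

divT-scale : ∀ x b → divT (scale x b) ≡ scale x (divT b)
divT-scale x []      = refl
divT-scale x (_ ∷ b) = refl

scale-*ₚ : ∀ x b c → scale x b *ₚ c ≈ₚ scale x (b *ₚ c)
scale-*ₚ x b c zero = begin
  coeff (scale x b *ₚ c) 0           ≡⟨ coeff-*ₚ-zero (scale x b) c ⟩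
  coeff (scale x b) 0 ∧ coeff c 0    ≡⟨ cong (_∧ coeff c 0) (coeff-scale x b 0) ⟩
  (x ∧ coeff b 0) ∧ coeff c 0        ≡⟨ ∧-assoc x _ _ ⟩
  x ∧ (coeff b 0 ∧ coeff c 0)        ≡⟨ cong (x ∧_) (sym (coeff-*ₚ-zero b c)) ⟩
  x ∧ coeff (b *ₚ c) 0               ≡⟨ sym (coeff-scale x (b *ₚ c) 0) ⟩
  coeff (scale x (b *ₚ c)) 0         ∎
  where open ≡-Reasoning
scale-*ₚ x b c (suc i) = begin
  coeff (scale x b *ₚ c) (suc i)
    ≡⟨ coeff-*ₚ-suc (scale x b) c i ⟩
  (coeff (scale x b) 0 ∧ coeff c (suc i)) xor coeff (divT (scale x b) *ₚ c) i
    ≡⟨ cong₂ _xor_ (trans (cong (_∧ coeff c (suc i)) (coeff-scale x b 0)) (∧-assoc x _ _))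
                   (trans (cong (λ p → coeff (p *ₚ c) i) (divT-scale x b))
                          (trans (scale-*ₚ x (divT b) c i) (coeff-scale x (divT b *ₚ c) i))) ⟩
  (x ∧ (coeff b 0 ∧ coeff c (suc i))) xor (x ∧ coeff (divT b *ₚ c) i)
    ≡⟨ sym (∧-distribˡ-xor x _ _) ⟩
  x ∧ ((coeff b 0 ∧ coeff c (suc i)) xor coeff (divT b *ₚ c) i)
    ≡⟨ cong (x ∧_) (sym (coeff-*ₚ-suc b c i)) ⟩
  x ∧ coeff (b *ₚ c) (suc i)
    ≡⟨ sym (coeff-scale x (b *ₚ c) (suc i)) ⟩
  coeff (scale x (b *ₚ c)) (suc i) ∎
  where open ≡-Reasoning

shift-*ₚ : ∀ n p c → shift n p *ₚ c ≈ₚ shift n (p *ₚ c)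
shift-*ₚ zero    p c i       = refl
shift-*ₚ (suc n) p c zero    = coeff-*ₚ-zero (shift (suc n) p) c
shift-*ₚ (suc n) p c (suc i) = trans (coeff-*ₚ-suc (shift (suc n) p) c i) (shift-*ₚ n p c i)

*ₚ-shift : ∀ a n q → a *ₚ shift n q ≈ₚ shift n (a *ₚ q)
*ₚ-shift a zero    q i       = refl
*ₚ-shift a (suc n) q zero    = trans (coeff-*ₚ-zero a (shift (suc n) q)) (∧-zeroʳ _)
*ₚ-shift a (suc n) q (suc i) = trans (coeff-*ₚ-sucʳ a (shift (suc n) q) i) (*ₚ-shift a n q i)

*ₚ-assoc : ∀ a b c → (a *ₚ b) *ₚ c ≈ₚ a *ₚ (b *ₚ c)
*ₚ-assoc []      b c i = refl
*ₚ-assoc (x ∷ a) b c = begin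
  (scale x b +ₚ shift 1 (a *ₚ b)) *ₚ c
    ≈⟨ *ₚ-distribʳ-+ₚ (scale x b) (shift 1 (a *ₚ b)) c ⟩
  scale x b *ₚ c +ₚ shift 1 (a *ₚ b) *ₚ c
    ≈⟨ +ₚ-cong {scale x b *ₚ c} {scale x (b *ₚ c)} (scale-*ₚ x b c) (shift-*ₚ 1 (a *ₚ b) c) ⟩
  scale x (b *ₚ c) +ₚ shift 1 ((a *ₚ b) *ₚ c)
    ≈⟨ +ₚ-cong {scale x (b *ₚ c)} {scale x (b *ₚ c)} {shift 1 ((a *ₚ b) *ₚ c)}
               (≈ₚ-refl {scale x (b *ₚ c)}) (shift-cong 1 {(a *ₚ b) *ₚ c} {a *ₚ (b *ₚ c)} (*ₚ-assoc a b c)) ⟩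
  scale x (b *ₚ c) +ₚ shift 1 (a *ₚ (b *ₚ c))
    ∎
  where open ≈ₚ-Reasoning

^ₚ-suc-*ₚ : ∀ m k q → m ^ₚ k *ₚ (m *ₚ q) ≈ₚ m ^ₚ suc k *ₚ q
^ₚ-suc-*ₚ m k q = begin
  m ^ₚ k *ₚ (m *ₚ q)   ≈⟨ *ₚ-assoc (m ^ₚ k) m q ⟨
  (m ^ₚ k *ₚ m) *ₚ q   ≈⟨ *ₚ-cong {m ^ₚ k *ₚ m} {m *ₚ m ^ₚ k} {q} {q} (*ₚ-comm (m ^ₚ k) m) (≈ₚ-refl {q}) ⟩
  (m *ₚ m ^ₚ k) *ₚ q   ∎
  where open ≈ₚ-Reasoning

-- The map T

T-odd : ∀ m f → coeff f 0 ≡ true → T m f ≈ₚ divT (m *ₚ f)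
T-odd m f f₀ i = begin
  coeff (T m f) i                   ≡⟨ cong (λ b → coeff (if b then divT (m *ₚ f +ₚ oneₚ) else divT f) i) f₀ ⟩
  coeff (divT (m *ₚ f +ₚ oneₚ)) i   ≡⟨ divT-+ₚ (m *ₚ f) oneₚ i ⟩
  coeff (divT (m *ₚ f) +ₚ []) i     ≡⟨ coeff-+ₚ (divT (m *ₚ f)) [] i ⟩
  coeff (divT (m *ₚ f)) i xor false ≡⟨ xor-identityʳ _ ⟩
  coeff (divT (m *ₚ f)) i           ∎
  where open ≡-Reasoning

T-even : ∀ m f → coeff f 0 ≡ false → T m f ≈ₚ divT f
T-even m f f₀ i = cong (λ b → coeff (if b then divT (m *ₚ f +ₚ oneₚ) else divT f) i) f₀

infix 4 _≈_mod-t^_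
_≈_mod-t^_ : Poly → Poly → ℕ → Set
f ≈ g mod-t^ N = ∀ i → i < N → coeff f i ≡ coeff g i

+ₚ-shift-mod : ∀ g N q → g +ₚ shift N q ≈ g mod-t^ N
+ₚ-shift-mod g N q i i<N =
  trans (coeff-+ₚ g (shift N q) i) (trans (cong (coeff g i xor_) (coeff-shift-< N q i<N)) (xor-identityʳ _))

T-+ₚ-shift : ∀ m N f g q → f ≈ₚ g +ₚ shift (suc N) q →
             T m f ≈ₚ T m g +ₚ shift N (if coeff g 0 then m *ₚ q else q)
T-+ₚ-shift m N f g q f≈ = by-parity (coeff g 0) refl
  where
  open ≈ₚ-Reasoning
  f₀≡g₀ : coeff f 0 ≡ coeff g 0
  f₀≡g₀ = trans (f≈ 0) (+ₚ-shift-mod g (suc N) q 0 (s≤s z≤n))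
  by-parity : ∀ c → coeff g 0 ≡ c → T m f ≈ₚ T m g +ₚ shift N (if c then m *ₚ q else q)
  by-parity true g₀ = begin
    T m f
      ≈⟨ T-odd m f (trans f₀≡g₀ g₀) ⟩
    divT (m *ₚ f)
      ≈⟨ divT-cong {m *ₚ f} {m *ₚ (g +ₚ shift (suc N) q)} (*ₚ-cong {m} {m} {f} (≈ₚ-refl {m}) f≈) ⟩
    divT (m *ₚ (g +ₚ shift (suc N) q))
      ≈⟨ divT-cong {m *ₚ (g +ₚ shift (suc N) q)} {m *ₚ g +ₚ m *ₚ shift (suc N) q} (*ₚ-distribˡ-+ₚ m g _) ⟩
    divT (m *ₚ g +ₚ m *ₚ shift (suc N) q)
      ≈⟨ divT-+ₚ (m *ₚ g) _ ⟩
    divT (m *ₚ g) +ₚ divT (m *ₚ shift (suc N) q)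
      ≈⟨ +ₚ-cong {divT (m *ₚ g)} {divT (m *ₚ g)} (≈ₚ-refl {divT (m *ₚ g)})
                 (divT-cong {m *ₚ shift (suc N) q} {shift (suc N) (m *ₚ q)} (*ₚ-shift m (suc N) q)) ⟩
    divT (m *ₚ g) +ₚ shift N (m *ₚ q)
      ≈⟨ +ₚ-cong {T m g} {divT (m *ₚ g)} {shift N (m *ₚ q)} (T-odd m g g₀) (≈ₚ-refl {shift N (m *ₚ q)}) ⟨
    T m g +ₚ shift N (m *ₚ q)
      ∎
  by-parity false g₀ = begin
    T m f                        ≈⟨ T-even m f (trans f₀≡g₀ g₀) ⟩
    divT f                       ≈⟨ divT-cong {f} {g +ₚ shift (suc N) q} f≈ ⟩
    divT (g +ₚ shift (suc N) q)  ≈⟨ divT-+ₚ g _ ⟩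
    divT g +ₚ shift N q          ≈⟨ +ₚ-cong {T m g} {divT g} {shift N q} (T-even m g g₀) (≈ₚ-refl {shift N q}) ⟨
    T m g +ₚ shift N q           ∎

prefix-+ₚ-shift : ∀ m N f g q → f ≈ₚ g +ₚ shift N q → prefix m N f ≡ prefix m N g
prefix-+ₚ-shift m zero    f g q f≈ = refl
prefix-+ₚ-shift m (suc N) f g q f≈ =
  cong₂ Vec._∷_ (trans (f≈ 0) (+ₚ-shift-mod g (suc N) q 0 (s≤s z≤n)))
                (prefix-+ₚ-shift m N (T m f) (T m g) _ (T-+ₚ-shift m N f g q f≈))

^ₚ-weight-∷ : ∀ m c {n} (v : Vec Bool n) q →
              m ^ₚ weight v *ₚ (if c then m *ₚ q else q) ≈ₚ m ^ₚ weight (c Vec.∷ v) *ₚ q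
^ₚ-weight-∷ m true  v q = ^ₚ-suc-*ₚ m (weight v) q
^ₚ-weight-∷ m false v q = ≈ₚ-refl {m ^ₚ weight v *ₚ q}

Tⁿ-+ₚ-shift : ∀ m N f g q → f ≈ₚ g +ₚ shift N q →
              Tⁿ m N f ≈ₚ Tⁿ m N g +ₚ m ^ₚ weight (prefix m N g) *ₚ q
Tⁿ-+ₚ-shift m zero f g q f≈ = begin
  f                 ≈⟨ f≈ ⟩
  g +ₚ q            ≈⟨ +ₚ-cong {g} {g} {oneₚ *ₚ q} {q} (≈ₚ-refl {g}) (*ₚ-identityˡ q) ⟨
  g +ₚ oneₚ *ₚ q    ∎
  where open ≈ₚ-Reasoning
Tⁿ-+ₚ-shift m (suc N) f g q f≈ = begin
  Tⁿ m N (T m f)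
    ≈⟨ Tⁿ-+ₚ-shift m N (T m f) (T m g) q′ (T-+ₚ-shift m N f g q f≈) ⟩
  Tⁿ m N (T m g) +ₚ m ^ₚ weight (prefix m N (T m g)) *ₚ q′
    ≈⟨ +ₚ-cong {Tⁿ m N (T m g)} {Tⁿ m N (T m g)} {m ^ₚ weight (prefix m N (T m g)) *ₚ q′}
               (≈ₚ-refl {Tⁿ m N (T m g)}) (^ₚ-weight-∷ m (coeff g 0) (prefix m N (T m g)) q) ⟩
  Tⁿ m N (T m g) +ₚ m ^ₚ weight (prefix m (suc N) g) *ₚ q ∎
  where
  open ≈ₚ-Reasoning
  q′ : Poly
  q′ = if coeff g 0 then m *ₚ q else q

-- Agreement modulo t^N

take-mod : ∀ N p → take N p ≈ p mod-t^ N
take-mod (suc N) []      i       _         = refl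
take-mod (suc N) (x ∷ p) zero    _         = refl
take-mod (suc N) (x ∷ p) (suc i) (s≤s i<N) = take-mod N p i i<N

take-DegLt : ∀ N p → DegLt (take N p) N
take-DegLt zero    p       i       _         = refl
take-DegLt (suc N) []      i       _         = refl
take-DegLt (suc N) (x ∷ p) (suc i) (s≤s N≤i) = take-DegLt N p i N≤i

DegLt-∷ : ∀ {x p N} → DegLt p N → DegLt (x ∷ p) (suc N)
DegLt-∷ p<N (suc i) (s≤s N≤i) = p<N i N≤i

coeff-shift-drop : ∀ N f i → N ≤ i → coeff (shift N (drop N f)) i ≡ coeff f i
coeff-shift-drop zero    f       i       _         = refl
coeff-shift-drop (suc N) []      (suc i) (s≤s N≤i) =
  trans (cong (λ q → coeff (shift N q) i) (sym (drop-[] N))) (coeff-shift-drop N [] i N≤i)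
coeff-shift-drop (suc N) (x ∷ f) (suc i) (s≤s N≤i) = coeff-shift-drop N f i N≤i

mod⇒+ₚ-shift-drop : ∀ N f g → DegLt g N → f ≈ g mod-t^ N → f ≈ₚ g +ₚ shift N (drop N f)
mod⇒+ₚ-shift-drop N f g g<N f≈g i with <-≤-connex i N
... | inj₁ i<N = trans (f≈g i i<N) (sym (+ₚ-shift-mod g N (drop N f) i i<N))
... | inj₂ N≤i = sym (begin
  coeff (g +ₚ shift N (drop N f)) i            ≡⟨ coeff-+ₚ g (shift N (drop N f)) i ⟩
  coeff g i xor coeff (shift N (drop N f)) i   ≡⟨ cong (_xor coeff (shift N (drop N f)) i) (g<N i N≤i) ⟩
  coeff (shift N (drop N f)) i                 ≡⟨ coeff-shift-drop N f i N≤i ⟩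
  coeff f i                                    ∎)
  where open ≡-Reasoning

mod⇒≈ₚ : ∀ N f g → DegLt f N → DegLt g N → f ≈ g mod-t^ N → f ≈ₚ g
mod⇒≈ₚ N f g f<N g<N f≈g i with <-≤-connex i N
... | inj₁ i<N = f≈g i i<N
... | inj₂ N≤i = trans (f<N i N≤i) (sym (g<N i N≤i))

prefix-mod : ∀ m N {f f′} → f ≈ f′ mod-t^ N → prefix m N f ≡ prefix m N f′
prefix-mod m N {f} {f′} f≈f′ = trans (via-take f (λ _ _ → refl)) (sym (via-take f′ f′≈f))
  where
  f′≈f : f′ ≈ f mod-t^ N
  f′≈f i i<N = sym (f≈f′ i i<N)
  via-take : ∀ h → h ≈ f mod-t^ N → prefix m N h ≡ prefix m N (take N f)
  via-take h h≈f = prefix-+ₚ-shift m N h (take N f) (drop N h)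
    (mod⇒+ₚ-shift-drop N h (take N f) (take-DegLt N f) (λ i i<N → trans (h≈f i i<N) (sym (take-mod N f i i<N))))

module Odd (m : Poly) (m₀ : coeff m 0 ≡ true) where

  coeff-*ₚ-odd-zero : ∀ a → coeff (m *ₚ a) 0 ≡ coeff a 0
  coeff-*ₚ-odd-zero a = trans (coeff-*ₚ-zero m a) (cong (_∧ coeff a 0) m₀)

  *ₚ-cancelˡ-mod : ∀ k a b → m *ₚ a ≈ m *ₚ b mod-t^ k → a ≈ b mod-t^ k
  *ₚ-cancelˡ-mod (suc k) a b ma≈mb = a≈b
    where
    a₀≡b₀ : coeff a 0 ≡ coeff b 0
    a₀≡b₀ = trans (sym (coeff-*ₚ-odd-zero a)) (trans (ma≈mb 0 (s≤s z≤n)) (coeff-*ₚ-odd-zero b))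
    tails : m *ₚ divT a ≈ m *ₚ divT b mod-t^ k
    tails j j<k = xor-cancelˡ (coeff a 0 ∧ coeff m (suc j)) (begin
      (coeff a 0 ∧ coeff m (suc j)) xor coeff (m *ₚ divT a) j  ≡⟨ coeff-*ₚ-sucʳ m a j ⟨
      coeff (m *ₚ a) (suc j)                                   ≡⟨ ma≈mb (suc j) (s≤s j<k) ⟩
      coeff (m *ₚ b) (suc j)                                   ≡⟨ coeff-*ₚ-sucʳ m b j ⟩
      (coeff b 0 ∧ coeff m (suc j)) xor coeff (m *ₚ divT b) j  ≡⟨ cong (λ x → (x ∧ coeff m (suc j)) xor _) a₀≡b₀ ⟨
      (coeff a 0 ∧ coeff m (suc j)) xor coeff (m *ₚ divT b) j  ∎)
      where open ≡-Reasoning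
    a≈b : a ≈ b mod-t^ suc k
    a≈b zero    _         = a₀≡b₀
    a≈b (suc i) (s≤s i<k) =
      trans (sym (coeff-divT a i)) (trans (*ₚ-cancelˡ-mod k (divT a) (divT b) tails i i<k) (coeff-divT b i))

  T-reflects-mod : ∀ N f f′ → coeff f 0 ≡ coeff f′ 0 → T m f ≈ T m f′ mod-t^ N → f ≈ f′ mod-t^ suc N
  T-reflects-mod N f f′ f₀≡f′₀ Tf≈Tf′ = by-parity (coeff f 0) refl
    where
    by-parity : ∀ c → coeff f 0 ≡ c → f ≈ f′ mod-t^ suc N
    by-parity false f₀ zero    _         = f₀≡f′₀
    by-parity false f₀ (suc i) (s≤s i<N) = begin
      coeff f (suc i)       ≡⟨ sym (coeff-divT f i) ⟩
      coeff (divT f) i      ≡⟨ sym (T-even m f f₀ i) ⟩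
      coeff (T m f) i       ≡⟨ Tf≈Tf′ i i<N ⟩
      coeff (T m f′) i      ≡⟨ T-even m f′ (trans (sym f₀≡f′₀) f₀) i ⟩
      coeff (divT f′) i     ≡⟨ coeff-divT f′ i ⟩
      coeff f′ (suc i)      ∎
      where open ≡-Reasoning
    by-parity true  f₀ = *ₚ-cancelˡ-mod (suc N) f f′ mf≈mf′
      where
      mf≈mf′ : m *ₚ f ≈ m *ₚ f′ mod-t^ suc N
      mf≈mf′ zero    _         = trans (coeff-*ₚ-odd-zero f) (trans f₀≡f′₀ (sym (coeff-*ₚ-odd-zero f′)))
      mf≈mf′ (suc i) (s≤s i<N) = begin
        coeff (m *ₚ f) (suc i)         ≡⟨ sym (coeff-divT (m *ₚ f) i) ⟩
        coeff (divT (m *ₚ f)) i        ≡⟨ sym (T-odd m f f₀ i) ⟩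
        coeff (T m f) i                ≡⟨ Tf≈Tf′ i i<N ⟩
        coeff (T m f′) i               ≡⟨ T-odd m f′ (trans (sym f₀≡f′₀) f₀) i ⟩
        coeff (divT (m *ₚ f′)) i       ≡⟨ coeff-divT (m *ₚ f′) i ⟩
        coeff (m *ₚ f′) (suc i)        ∎
        where open ≡-Reasoning

  prefix-injective-mod : ∀ N f f′ → prefix m N f ≡ prefix m N f′ → f ≈ f′ mod-t^ N
  prefix-injective-mod (suc N) f f′ eq =
    T-reflects-mod N f f′ (cong Vec.head eq) (prefix-injective-mod N (T m f) (T m f′) (cong Vec.tail eq))

  -- Digit by digit: u = r(0) + t u′ where m u′ ≡ (r + r(0) m)/t, using m(0) = 1.
  *ₚ-invertible-mod : ∀ k r → ∃[ u ] DegLt u k × m *ₚ u ≈ r mod-t^ k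
  *ₚ-invertible-mod zero    r = [] , (λ _ _ → refl) , λ _ ()
  *ₚ-invertible-mod (suc k) r with *ₚ-invertible-mod k (divT (r +ₚ scale (coeff r 0) m))
  ... | u , u<k , mu≈r′ = coeff r 0 ∷ u , DegLt-∷ u<k , mu≈r
    where
    x : Bool
    x = coeff r 0
    mu≈r : m *ₚ (x ∷ u) ≈ r mod-t^ suc k
    mu≈r zero    _         = coeff-*ₚ-odd-zero (x ∷ u)
    mu≈r (suc j) (s≤s j<k) = begin
      coeff (m *ₚ (x ∷ u)) (suc j)           ≡⟨ coeff-*ₚ-sucʳ m (x ∷ u) j ⟩
      xm xor coeff (m *ₚ u) j                ≡⟨ cong (xm xor_) (mu≈r′ j j<k) ⟩
      xm xor coeff (divT (r +ₚ scale x m)) j ≡⟨ cong (xm xor_) (coeff-divT (r +ₚ scale x m) j) ⟩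
      xm xor coeff (r +ₚ scale x m) (suc j)  ≡⟨ cong (xm xor_) (coeff-+ₚ r (scale x m) (suc j)) ⟩
      xm xor (r′ xor coeff (scale x m) (suc j))
                                             ≡⟨ cong (λ y → xm xor (r′ xor y)) (coeff-scale x m (suc j)) ⟩
      xm xor (r′ xor xm)                     ≡⟨ x∙yz≈y∙xz xm r′ xm ⟩
      r′ xor (xm xor xm)                     ≡⟨ cong (r′ xor_) (xor-same xm) ⟩
      r′ xor false                           ≡⟨ xor-identityʳ r′ ⟩
      r′                                     ∎
      where
      open ≡-Reasoning
      xm r′ : Bool
      xm = x ∧ coeff m (suc j)
      r′ = coeff r (suc j)

  prefix-≡⇒≈ₚ : ∀ N f g → DegLt f N → DegLt g N → prefix m N f ≡ prefix m N g → f ≈ₚ g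
  prefix-≡⇒≈ₚ N f g f<N g<N eq = mod⇒≈ₚ N f g f<N g<N (prefix-injective-mod N f g eq)

  prefix-≡⇒+ₚ-shift : ∀ N f g → DegLt g N → prefix m N f ≡ prefix m N g → f ≈ₚ g +ₚ shift N (drop N f)
  prefix-≡⇒+ₚ-shift N f g g<N eq = mod⇒+ₚ-shift-drop N f g g<N (prefix-injective-mod N f g eq)

  -- T f ≡ g mod t^N for odd f means m f ≡ 1 + t g mod t^(N+1)
  T-surjective-mod : ∀ N c g → ∃[ f ] DegLt f (suc N) × coeff f 0 ≡ c × T m f ≈ g mod-t^ N
  T-surjective-mod N false g = false ∷ take N g , DegLt-∷ (take-DegLt N g) , refl , take-mod N g
  T-surjective-mod N true  g with *ₚ-invertible-mod (suc N) (true ∷ g)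
  ... | f , f<N+1 , mf≈1+tg = f , f<N+1 , f₀ , Tf≈g
    where
    f₀ : coeff f 0 ≡ true
    f₀ = trans (sym (coeff-*ₚ-odd-zero f)) (mf≈1+tg 0 (s≤s z≤n))
    Tf≈g : T m f ≈ g mod-t^ N
    Tf≈g i i<N = trans (T-odd m f f₀ i) (trans (coeff-divT (m *ₚ f) i) (mf≈1+tg (suc i) (s≤s i<N)))

  prefix-surjective : ∀ N (p : Vec Bool N) → ∃[ g ] DegLt g N × prefix m N g ≡ p
  prefix-surjective zero    Vec.[]       = [] , (λ _ _ → refl) , refl
  prefix-surjective (suc N) (c Vec.∷ p) with prefix-surjective N p
  ... | g , _ , g↦p with T-surjective-mod N c g
  ... | f , f<N+1 , f₀ , Tf≈g = f , f<N+1 , cong₂ Vec._∷_ f₀ (trans (prefix-mod m N Tf≈g) g↦p)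

  coeffs : (N : ℕ) → Poly → Vec Bool N
  coeffs zero    g = Vec.[]
  coeffs (suc N) g = coeff g 0 Vec.∷ coeffs N (divT g)

  coeffs-mod : ∀ N g → toList (coeffs N g) ≈ g mod-t^ N
  coeffs-mod (suc N) g zero    _         = refl
  coeffs-mod (suc N) g (suc i) (s≤s i<N) = trans (coeffs-mod N (divT g) i i<N) (coeff-divT g i)

  toList-mod-injective : ∀ N (c c′ : Vec Bool N) → toList c ≈ toList c′ mod-t^ N → c ≡ c′
  toList-mod-injective zero    Vec.[]       Vec.[]         _    = refl
  toList-mod-injective (suc N) (x Vec.∷ c) (x′ Vec.∷ c′) c≈c′ =
    cong₂ Vec._∷_ (c≈c′ 0 (s≤s z≤n)) (toList-mod-injective N c c′ (λ i i<N → c≈c′ (suc i) (s≤s i<N)))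

  Φ-bijective : ∀ N → Bijective _≡_ _≡_ (Φ m N)
  Φ-bijective N = injective , strictlySurjective⇒surjective strictlySurjective
    where
    injective : ∀ {c c′} → Φ m N c ≡ Φ m N c′ → c ≡ c′
    injective {c} {c′} eq = toList-mod-injective N c c′ (prefix-injective-mod N (toList c) (toList c′) eq)
    strictlySurjective : ∀ p → ∃[ c ] Φ m N c ≡ p
    strictlySurjective p with prefix-surjective N p
    ... | g , _ , g↦p = coeffs N g , trans (prefix-mod m N (coeffs-mod N g)) g↦p

-- Degrees

DegLt-*ₚ-zero : ∀ a b → DegLt a 0 → DegLt (a *ₚ b) 0
DegLt-*ₚ-zero a b a≈0 zero    _ = trans (coeff-*ₚ-zero a b) (cong (_∧ coeff b 0) (a≈0 0 z≤n))
DegLt-*ₚ-zero a b a≈0 (suc i) _ =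
  trans (coeff-*ₚ-suc a b i)
    (cong₂ (λ x y → (x ∧ coeff b (suc i)) xor y) (a≈0 0 z≤n)
           (DegLt-*ₚ-zero (divT a) b (λ j _ → trans (coeff-divT a j) (a≈0 (suc j) z≤n)) i z≤n))

DegLt-*ₚ : ∀ j n a b → DegLt a j → DegLt b (suc n) → DegLt (a *ₚ b) (j + n)
DegLt-*ₚ zero    n a b a<0   _     i       _           = DegLt-*ₚ-zero a b a<0 i z≤n
DegLt-*ₚ (suc j) n a b a<j+1 b<n+1 (suc i) (s≤s j+n≤i) = begin
  coeff (a *ₚ b) (suc i)
    ≡⟨ coeff-*ₚ-suc a b i ⟩
  (coeff a 0 ∧ coeff b (suc i)) xor coeff (divT a *ₚ b) i
    ≡⟨ cong₂ (λ x y → (coeff a 0 ∧ x) xor y)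
             (b<n+1 (suc i) (s≤s (≤-trans (m≤n+m n j) j+n≤i)))
             (DegLt-*ₚ j n (divT a) b divTa<j b<n+1 i j+n≤i) ⟩
  (coeff a 0 ∧ false) xor false
    ≡⟨ xor-identityʳ _ ⟩
  coeff a 0 ∧ false
    ≡⟨ ∧-zeroʳ _ ⟩
  false
    ∎
  where
  open ≡-Reasoning
  divTa<j : DegLt (divT a) j
  divTa<j k j≤k = trans (coeff-divT a k) (a<j+1 (suc k) (s≤s j≤k))

T-DegLt-even : ∀ m n g → coeff g 0 ≡ false → DegLt g (suc n) → DegLt (T m g) n
T-DegLt-even m n g g₀ g<n+1 i n≤i =
  trans (T-even m g g₀ i) (trans (coeff-divT g i) (g<n+1 (suc i) (s≤s n≤i)))

T-DegLt-odd : ∀ m d n g → DegLt m (suc d) → coeff g 0 ≡ true → DegLt g (suc n) → DegLt (T m g) (n + d)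
T-DegLt-odd m d n g m<d+1 g₀ g<n+1 i n+d≤i =
  trans (T-odd m g g₀ i)
    (trans (coeff-divT (m *ₚ g) i)
      (DegLt-*ₚ (suc d) n m g m<d+1 g<n+1 (suc i) (s≤s (subst (_≤ i) (+-comm n d) n+d≤i))))

Tⁿ-DegLt : ∀ m d → DegLt m (suc d) → ∀ N e g →
           DegLt g (N + e) → DegLt (Tⁿ m N g) (e + d * weight (prefix m N g))
Tⁿ-DegLt m d m<d+1 zero    e g g<e = subst (DegLt g) (sym (trans (cong (e +_) (*-zeroʳ d)) (+-identityʳ e))) g<e
Tⁿ-DegLt m d m<d+1 (suc N) e g g< = by-parity (coeff g 0) refl
  where
  by-parity : ∀ c → coeff g 0 ≡ c → DegLt (Tⁿ m N (T m g)) (e + d * weight (c Vec.∷ prefix m N (T m g)))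
  by-parity false g₀ = Tⁿ-DegLt m d m<d+1 N e (T m g) (T-DegLt-even m (N + e) g g₀ g<)
  by-parity true  g₀ =
    subst (DegLt (Tⁿ m N (T m g)))
      (trans (+-assoc e d _) (cong (e +_) (sym (*-suc d (weight (prefix m N (T m g)))))))
      (Tⁿ-DegLt m d m<d+1 N (e + d) (T m g)
        (subst (DegLt (T m g)) (+-assoc N e d) (T-DegLt-odd m d (N + e) g m<d+1 g₀ g<)))

lemma1 : (m : Poly) (d : ℕ) → coeff m 0 ≡ true → Deg m d →
    (N : ℕ) → 1 ≤ N →
    (∀ f f′ → (∀ i → i < N → coeff f i ≡ coeff f′ i) → prefix m N f ≡ prefix m N f′)
    × (∀ (p : Vec Bool N) →
         Σ Poly λ g → DegLt g N × prefix m N g ≡ p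
           × (∀ g′ → DegLt g′ N → prefix m N g′ ≡ p → g′ ≈ₚ g)
           × Σ Poly λ h → DegLt h (d * weight p)
               × (∀ f → (prefix m N f ≡ p → ∃ λ q → f ≈ₚ g +ₚ shift N q)
                        × ((∃ λ q → f ≈ₚ g +ₚ shift N q) → prefix m N f ≡ p))
               × (∀ f q → f ≈ₚ g +ₚ shift N q →
                    Tⁿ m N f ≈ₚ h +ₚ (m ^ₚ weight p) *ₚ q))
    × Bijective _≡_ _≡_ (Φ m N)
lemma1 m d m₀ deg-m N _ =
    (λ f f′ → prefix-mod m N)
  , (λ p → let g , g<N , g↦p = prefix-surjective N p in
        g , g<N , g↦p
      , (λ g′ g′<N g′↦p → prefix-≡⇒≈ₚ N g′ g g′<N g<N (trans g′↦p (sym g↦p)))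
      , Tⁿ m N g
      , subst (λ v → DegLt (Tⁿ m N g) (d * weight v)) g↦p
          (Tⁿ-DegLt m d (Deg.above deg-m) N 0 g (subst (DegLt g) (sym (+-identityʳ N)) g<N))
      , (λ f → (λ f↦p → drop N f , prefix-≡⇒+ₚ-shift N f g g<N (trans f↦p (sym g↦p)))
             , λ (q , f≈) → trans (prefix-+ₚ-shift m N f g q f≈) g↦p)
      , λ f q f≈ → subst (λ v → Tⁿ m N f ≈ₚ Tⁿ m N g +ₚ m ^ₚ weight v *ₚ q) g↦p
                          (Tⁿ-+ₚ-shift m N f g q f≈))
  , Φ-bijective N
  where open Odd m m₀
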